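{- Let $\mathfrak E\subseteq\mathfrak A$ be finite symmetric integral relation algebras. Then the map $a\mapsto J(a,0)$ is an isomorphism from $\mathfrak A$ onto a subalgebra $\mathfrak A'$ of $\mathfrak C_{\mathfrak E}(\mathfrak A)$.
   Context: Relation algebras are symmetric ($\breve x=x$) and integral ($1'$ an atom); $0'=\overline{1'}$. For each atom $x$ of $\mathfrak A$ let $c(x)$ be the unique atom of $\mathfrak E$ with $x\le c(x)$. Let $T\subseteq\omega^3$ be defined by $T(i,j,k)$ iff $(i\le j=k)$ or $(j\le k=i)$ or $(k\le i=j)$. Let $\mathrm{At}=\{1'\}\cup\{x^{(i)}: x \text{ a diversity atom of }\mathfrak A,\ i\in\omega\}$ (the $x^{(i)}$ are distinct new symbols). Let $Cy\subseteq \mathrm{At}^3$ consist of all permutations of the triples $(1',1',1')$; $(1',x^{(i)},x^{(i)})$ for diversity atoms $x$ and $i\in\omega$; and $(x^{(i)},y^{(j)},z^{(k)})$ whenever $x,y,z$ are diversity atoms of $\mathfrak A$, $i,j,k\in\omega$, $x;y\ge z$ in $\mathfrak A$, and ($c(x)=c(y)=c(z)$ implies $T(i,j,k)$). $\mathfrak C_{\mathfrak E}(\mathfrak A)$ is the complex algebra with universe the power set of $\mathrm{At}$, set-theoretic Boolean operations, identity $\{1'\}$, converse the identity map, and $X;Y=\{w:\exists u\in X,\exists v\in Y,\ (u,v,w)\in Cy\}$; atoms are identified with singletons. For $a\in\mathfrak A$, $n\in\omega$: $J(a,n)=\{x^{(i)}: x\text{ a diversity atom of }\mathfrak A,\ x\le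 a,\ n\le i\in\omega\}\cup\{1' : 1'\le a\}$. -}

module Defs where

open import Data.Nat using (ℕ) renaming (_≤_ to _≤ℕ_)
open import Data.Fin using (Fin)
open import Data.Product using (Σ; ∃; ∃-syntax; _×_; _,_)
open import Data.Sum using (_⊎_)
open import Relation.Nullary using (¬_)
open import Relation.Binary.PropositionalEquality using (_≡_)
open import Function.Bundles using (_↔_)

record RelationAlgebra : Set₁ where
  infixl 6 _+_
  infixl 7 _⨟_
  infix 4 _≤_
  field
    Carrier : Set
    _+_     : Carrier → Carrier → Carrier
    -_      : Carrier → Carrier
    _⨟_     : Carrier → Carrier → Carrier
    _˘      : Carrier → Carrier
    1'      : Carrier
    +-comm   : ∀ x y → x + y ≡ y + x
    +-assoc  : ∀ x y z → x + (y + z) ≡ (x + y) + z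
    huntington : ∀ x y → - (- x + y) + - (- x + - y) ≡ x
    ⨟-assoc  : ∀ x y z → x ⨟ (y ⨟ z) ≡ (x ⨟ y) ⨟ z
    ⨟-distr  : ∀ x y z → (x + y) ⨟ z ≡ x ⨟ z + y ⨟ z
    ⨟-identʳ : ∀ x → x ⨟ 1' ≡ x
    ˘-invol  : ∀ x → (x ˘) ˘ ≡ x
    ˘-distr  : ∀ x y → (x + y) ˘ ≡ x ˘ + y ˘
    ˘-⨟      : ∀ x y → (x ⨟ y) ˘ ≡ (y ˘) ⨟ (x ˘)
    tarski   : ∀ x y → (x ˘) ⨟ (- (x ⨟ y)) + - y ≡ - y

  _≤_ : Carrier → Carrier → Set
  x ≤ y = x + y ≡ y

  𝟎 : Carrier
  𝟎 = - (1' + - 1')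

  0' : Carrier
  0' = - 1'

  IsAtom : Carrier → Set
  IsAtom x = ¬ (x ≡ 𝟎) × (∀ y → y ≤ x → (y ≡ 𝟎) ⊎ (y ≡ x))

  IsDiversityAtom : Carrier → Set
  IsDiversityAtom x = IsAtom x × x ≤ 0'

  IsFinite : Set
  IsFinite = ∃[ n ] (Carrier ↔ Fin n)

  IsSymmetric : Set
  IsSymmetric = ∀ x → x ˘ ≡ x

  IsIntegral : Set
  IsIntegral = IsAtom 1'

  record Subalgebra : Set₁ where
    field
      ∈E    : Carrier → Set
      1'∈   : ∈E 1'
      +∈    : ∀ {x y} → ∈E x → ∈E y → ∈E (x + y)
      -∈    : ∀ {x} → ∈E x → ∈E (- x)
      ⨟∈    : ∀ {x y} → ∈E x → ∈E y → ∈E (x ⨟ y)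
      ˘∈    : ∀ {x} → ∈E x → ∈E (x ˘)

    IsAtomE : Carrier → Set
    IsAtomE e = ∈E e × ¬ (e ≡ 𝟎) × (∀ y → ∈E y → y ≤ e → (y ≡ 𝟎) ⊎ (y ≡ e))

    -- c(x) = e : e is the (unique) atom of E above x
    IsC : Carrier → Carrier → Set
    IsC x e = IsAtomE e × x ≤ e

    SameC : Carrier → Carrier → Carrier → Set
    SameC x y z = ∃[ e ] (IsC x e × IsC y e × IsC z e)

T : ℕ → ℕ → ℕ → Set
T i j k = (i ≤ℕ j × j ≡ k) ⊎ (j ≤ℕ k × k ≡ i) ⊎ (k ≤ℕ i × i ≡ j)

module Construction (𝔄 : RelationAlgebra) (𝔈 : RelationAlgebra.Subalgebra 𝔄) where
  open RelationAlgebra 𝔄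
  open Subalgebra 𝔈

  -- At = {1'} ∪ {x^(i)}; the diversity-atom proof is irrelevant, so
  -- x^(i) depends only on x and i.
  data At : Set where
    ι  : At
    dv : (x : Carrier) → .(IsDiversityAtom x) → ℕ → At

  data Tri : At → At → At → Set where
    t111 : Tri ι ι ι
    t1xx : ∀ {x i} .{p : IsDiversityAtom x} → Tri ι (dv x p i) (dv x p i)
    txyz : ∀ {x y z i j k} .{p : IsDiversityAtom x} .{q : IsDiversityAtom y}
             .{r : IsDiversityAtom z} →
           z ≤ x ⨟ y → (SameC x y z → T i j k) →
           Tri (dv x p i) (dv y q j) (dv z r k)

  Cy : At → At → At → Set
  Cy u v w = Tri u v w ⊎ Tri u w v ⊎ Tri v u w ⊎ Tri v w u ⊎ Tri w u v ⊎ Tri w v u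

  Sub : Set₁
  Sub = At → Set

  _∪ᶜ_ : Sub → Sub → Sub
  (X ∪ᶜ Y) w = X w ⊎ Y w

  ∁ᶜ : Sub → Sub
  ∁ᶜ X w = ¬ X w

  _⨟ᶜ_ : Sub → Sub → Sub
  (X ⨟ᶜ Y) w = ∃[ u ] ∃[ v ] (X u × Y v × Cy u v w)

  ˘ᶜ : Sub → Sub
  ˘ᶜ X = X

  1ᶜ : Sub
  1ᶜ w = w ≡ ι

  _≐_ : Sub → Sub → Set
  X ≐ Y = (∀ w → X w → Y w) × (∀ w → Y w → X w)

  J : Carrier → ℕ → Sub
  J a n ι = 1' ≤ a
  J a n (dv x _ i) = x ≤ a × n ≤ℕ i

  -- f : 𝔄 → 𝔆_𝔈(𝔄) is an isomorphism onto a subalgebra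
  -- (= an injective homomorphism; its image is then a subalgebra)
  IsEmbedding : (Carrier → Sub) → Set
  IsEmbedding f =
      (∀ a b → f a ≐ f b → a ≡ b)
    × (∀ a b → f (a + b) ≐ (f a ∪ᶜ f b))
    × (∀ a → f (- a) ≐ ∁ᶜ (f a))
    × (∀ a b → f (a ⨟ b) ≐ (f a ⨟ᶜ f b))
    × (∀ a → f (a ˘) ≐ ˘ᶜ (f a))
    × (f 1' ≐ 1ᶜ)

-- A finite Boolean algebra is atomic, so a is determined by the atoms below it, and J(a,0)
-- consists exactly of the points 1' and x⁽ⁱ⁾ lying over those atoms; hence the Boolean
-- operations are preserved atomwise. For composition, an atom z ≤ a ; b lies in a triangle
-- z ≤ x ; y with atoms x ≤ a and y ≤ b (Schröder's cycle law, using symmetry); lifting x, y, z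
-- to one common index k gives a cycle of Cy because T(k,k,k) holds. Conversely every cycle
-- of Cy projects to a triangle of 𝔄, all of whose rotations are triangles by the cycle law.
module Submission where

open import Defs
open import Data.Nat using (ℕ; z≤n)
import Data.Nat.Properties as ℕ
import Data.Fin as Fin
open import Data.Product using (_,_; _×_; Σ; proj₁; proj₂)
import Data.Sum as Sum
open import Data.Sum using (_⊎_; inj₁; inj₂)
open import Data.Empty using (⊥-elim)
import Data.List as List
open import Data.List using (List; []; _∷_; allFin)
open import Data.List.Membership.Propositional using (_∈_)
open import Data.List.Membership.Propositional.Properties using (∈-map⁺; ∈-allFin)
open import Data.List.Relation.Unary.Any using (here; there)
open import Algebra.Bundles using (CommutativeSemigroup)
import Algebra.Properties.CommutativeSemigroup as CommutativeSemigroupProperties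
open import Function.Bundles using (Inverse)
open import Function.Properties.Inverse using (↔⇒↣)
open import Relation.Nullary using (¬_; Dec; yes; no)
open import Relation.Nullary.Decidable using (via-injection; recompute; toSum; ¬?; _×-dec_; _⊎-dec_)
open import Relation.Binary.Definitions using (DecidableEquality)
open import Relation.Binary.PropositionalEquality
  using (_≡_; refl; sym; trans; cong; cong₂; subst; subst₂; isEquivalence; module ≡-Reasoning)

module Huntington (𝔄 : RelationAlgebra) where
  open RelationAlgebra 𝔄
  open ≡-Reasoning

  +-commutativeSemigroup : CommutativeSemigroup _ _
  +-commutativeSemigroup = record
    { _∙_ = _+_
    ; isCommutativeSemigroup = record
      { isSemigroup = record
        { isMagma = record { isEquivalence = isEquivalence ; ∙-cong = cong₂ _+_ }
        ; assoc = λ x y z → sym (+-assoc x y z)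
        }
      ; comm = +-comm
      }
    }

  open CommutativeSemigroupProperties +-commutativeSemigroup
    using (interchange; x∙yz≈xz∙y)

  x+-x≡-x+--x : ∀ x → x + - x ≡ - x + - - x
  x+-x≡-x+--x x = begin
    x + - x
      ≡⟨ sym (cong₂ _+_ (huntington x (- - x)) (huntington (- x) (- - x))) ⟩
    (- (- x + - - x) + - (- x + - - - x)) + (- (- - x + - - x) + - (- - x + - - - x))
      ≡⟨ interchange _ _ _ _ ⟩
    (- (- x + - - x) + - (- - x + - - x)) + (- (- x + - - - x) + - (- - x + - - - x))
      ≡⟨ cong₂ _+_ (cong (λ y → - y + - (- - x + - - x)) (+-comm (- x) (- - x)))
                   (cong₂ (λ y z → - y + - z) (+-comm (- x) (- - - x)) (+-comm (- - x) (- - - x))) ⟩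
    (- (- - x + - x) + - (- - x + - - x)) + (- (- - - x + - x) + - (- - - x + - - x))
      ≡⟨ cong₂ _+_ (huntington (- x) (- x)) (huntington (- - x) (- x)) ⟩
    - x + - - x ∎

  -‿involutive : ∀ x → - - x ≡ x
  -‿involutive x = begin
    - - x                               ≡⟨ sym (huntington (- - x) (- x)) ⟩
    - (- - - x + - x) + - (- - - x + - - x)
      ≡⟨ cong₂ (λ y z → - y + - z) (+-comm (- - - x) (- x))
               (trans (+-comm (- - - x) (- - x)) (sym (x+-x≡-x+--x (- x)))) ⟩
    - (- x + - - - x) + - (- x + - - x) ≡⟨ +-comm _ _ ⟩
    - (- x + - - x) + - (- x + - - - x) ≡⟨ huntington x (- - x) ⟩
    x                                   ∎

  -‿injective : ∀ {x y} → - x ≡ - y → x ≡ y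
  -‿injective {x} {y} eq = begin
    x     ≡⟨ sym (-‿involutive x) ⟩
    - - x ≡⟨ cong -_ eq ⟩
    - - y ≡⟨ -‿involutive y ⟩
    y     ∎

  huntington′ : ∀ x y → - (x + y) + - (x + - y) ≡ - x
  huntington′ x y = begin
    - (x + y) + - (x + - y)         ≡⟨ cong (λ z → - (z + y) + - (z + - y)) (sym (-‿involutive x)) ⟩
    - (- - x + y) + - (- - x + - y) ≡⟨ huntington (- x) y ⟩
    - x                             ∎

  -- chosen so that 𝟎 = - ⊤ holds definitionally
  ⊤ : Carrier
  ⊤ = 1' + - 1'

  +-complementʳ : ∀ x → x + - x ≡ ⊤
  +-complementʳ x = begin
    x + - x
      ≡⟨ sym (cong₂ _+_ (huntington x 1') (huntington′ x 1')) ⟩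
    (- (- x + 1') + - (- x + - 1')) + (- (x + 1') + - (x + - 1'))
      ≡⟨ interchange _ _ _ _ ⟩
    (- (- x + 1') + - (x + 1')) + (- (- x + - 1') + - (x + - 1'))
      ≡⟨ +-comm _ _ ⟩
    (- (- x + - 1') + - (x + - 1')) + (- (- x + 1') + - (x + 1'))
      ≡⟨ cong₂ _+_ (+-comm _ _) (+-comm _ _) ⟩
    (- (x + - 1') + - (- x + - 1')) + (- (x + 1') + - (- x + 1'))
      ≡⟨ cong₂ _+_ (cong₂ (λ y z → - y + - z) (+-comm x (- 1')) (+-comm (- x) (- 1')))
                   (cong₂ (λ y z → - y + - z) (+-comm x 1') (+-comm (- x) 1')) ⟩
    (- (- 1' + x) + - (- 1' + - x)) + (- (1' + x) + - (1' + - x))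
      ≡⟨ cong₂ _+_ (huntington 1' x) (huntington′ 1' x) ⟩
    ⊤ ∎

  𝟎+-[x+x]≡-x : ∀ x → 𝟎 + - (x + x) ≡ - x
  𝟎+-[x+x]≡-x x = begin
    𝟎 + - (x + x)               ≡⟨ cong (λ y → - y + - (x + x)) (sym (+-complementʳ x)) ⟩
    - (x + - x) + - (x + x)     ≡⟨ cong (λ y → - (y + - x) + - (y + y)) (sym (-‿involutive x)) ⟩
    - (- - x + - x) + - (- - x + - - x) ≡⟨ huntington (- x) (- x) ⟩
    - x                         ∎

  x+⊤≡⊤ : ∀ x → x + ⊤ ≡ ⊤
  x+⊤≡⊤ x = begin
    x + ⊤                 ≡⟨ cong (x +_) (sym (+-complementʳ x)) ⟩
    x + (x + - x)         ≡⟨ cong (λ y → x + (x + y)) (sym (𝟎+-[x+x]≡-x x)) ⟩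
    x + (x + (𝟎 + - s))   ≡⟨ cong (x +_) (x∙yz≈xz∙y x 𝟎 (- s)) ⟩
    x + ((x + - s) + 𝟎)   ≡⟨ +-assoc x (x + - s) 𝟎 ⟩
    (x + (x + - s)) + 𝟎   ≡⟨ cong (_+ 𝟎) (+-assoc x x (- s)) ⟩
    (s + - s) + 𝟎         ≡⟨ cong (_+ 𝟎) (+-complementʳ s) ⟩
    ⊤ + - ⊤               ≡⟨ +-complementʳ ⊤ ⟩
    ⊤                     ∎
    where s = x + x

  𝟎+-[x+𝟎]≡-x : ∀ x → 𝟎 + - (x + 𝟎) ≡ - x
  𝟎+-[x+𝟎]≡-x x = trans (cong (λ y → - y + - (x + 𝟎)) (sym (x+⊤≡⊤ x))) (huntington′ x ⊤)

  +-identityʳ : ∀ x → x + 𝟎 ≡ x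
  +-identityʳ x = -‿injective (begin
    - (x + 𝟎)             ≡⟨ sym (𝟎+-[x+𝟎]≡-x (x + 𝟎)) ⟩
    𝟎 + - ((x + 𝟎) + 𝟎)   ≡⟨ cong (λ y → 𝟎 + - y) (sym (+-assoc x 𝟎 𝟎)) ⟩
    𝟎 + - (x + (𝟎 + 𝟎))   ≡⟨ cong (λ y → 𝟎 + - (x + y)) 𝟎+𝟎≡𝟎 ⟩
    𝟎 + - (x + 𝟎)         ≡⟨ 𝟎+-[x+𝟎]≡-x x ⟩
    - x                   ∎)
    where
    𝟎+𝟎≡𝟎 : 𝟎 + 𝟎 ≡ 𝟎
    𝟎+𝟎≡𝟎 = trans (cong (λ y → 𝟎 + - y) (sym (+-complementʳ ⊤))) (𝟎+-[x+𝟎]≡-x ⊤)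

  +-identityˡ : ∀ x → 𝟎 + x ≡ x
  +-identityˡ x = trans (+-comm 𝟎 x) (+-identityʳ x)

  +-idem : ∀ x → x + x ≡ x
  +-idem x = -‿injective (trans (sym (+-identityˡ (- (x + x)))) (𝟎+-[x+x]≡-x x))

  ≤-refl : ∀ {x} → x ≤ x
  ≤-refl {x} = +-idem x

  ≤-reflexive : ∀ {x y} → x ≡ y → x ≤ y
  ≤-reflexive refl = ≤-refl

  ≤-trans : ∀ {x y z} → x ≤ y → y ≤ z → x ≤ z
  ≤-trans {x} {y} {z} x≤y y≤z = begin
    x + z       ≡⟨ cong (x +_) (sym y≤z) ⟩
    x + (y + z) ≡⟨ +-assoc x y z ⟩
    (x + y) + z ≡⟨ cong (_+ z) x≤y ⟩
    y + z       ≡⟨ y≤z ⟩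
    z           ∎

  ≤-antisym : ∀ {x y} → x ≤ y → y ≤ x → x ≡ y
  ≤-antisym {x} {y} x≤y y≤x = trans (sym y≤x) (trans (+-comm y x) x≤y)

  x≤x+y : ∀ x y → x ≤ x + y
  x≤x+y x y = trans (+-assoc x x y) (cong (_+ y) (+-idem x))

  y≤x+y : ∀ x y → y ≤ x + y
  y≤x+y x y = subst (y ≤_) (+-comm y x) (x≤x+y y x)

  +-lub : ∀ {x y z} → x ≤ z → y ≤ z → x + y ≤ z
  +-lub {x} {y} {z} x≤z y≤z = trans (sym (+-assoc x y z)) (trans (cong (x +_) y≤z) x≤z)

  x≤𝟎⇒x≡𝟎 : ∀ {x} → x ≤ 𝟎 → x ≡ 𝟎
  x≤𝟎⇒x≡𝟎 {x} x≤𝟎 = ≤-antisym x≤𝟎 (+-identityˡ x)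

  -‿antitone : ∀ {x y} → x ≤ y → - y ≤ - x
  -‿antitone {x} {y} x≤y = subst (- y ≤_) -x≡-y+r (x≤x+y (- y) (- (x + - y)))
    where
    -x≡-y+r : - y + - (x + - y) ≡ - x
    -x≡-y+r = trans (cong (λ z → - z + - (x + - y)) (sym x≤y)) (huntington′ x y)

  x≤-y⇒y≤-x : ∀ {x y} → x ≤ - y → y ≤ - x
  x≤-y⇒y≤-x {x} {y} x≤-y = subst (_≤ - x) (-‿involutive y) (-‿antitone x≤-y)

  infixl 7 _·_
  _·_ : Carrier → Carrier → Carrier
  x · y = - (- x + - y)

  x·y≤x : ∀ x y → x · y ≤ x
  x·y≤x x y = subst (x · y ≤_) (-‿involutive x) (-‿antitone (x≤x+y (- x) (- y)))

  x·y≤y : ∀ x y → x · y ≤ y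
  x·y≤y x y = subst (x · y ≤_) (-‿involutive y) (-‿antitone (y≤x+y (- x) (- y)))

  ·-glb : ∀ {x y z} → x ≤ y → x ≤ z → x ≤ y · z
  ·-glb x≤y x≤z = x≤-y⇒y≤-x (+-lub (-‿antitone x≤y) (-‿antitone x≤z))

  x·-x≡𝟎 : ∀ x → x · - x ≡ 𝟎
  x·-x≡𝟎 x = cong -_ (+-complementʳ (- x))

  x·y≡𝟎⇒x≤-y : ∀ {x y} → x · y ≡ 𝟎 → x ≤ - y
  x·y≡𝟎⇒x≤-y {x} {y} x·y≡𝟎 = subst (_≤ - y) x·-y≡x (x·y≤y x (- y))
    where
    x·-y≡x : x · - y ≡ x
    x·-y≡x = begin
      x · - y         ≡⟨ sym (+-identityˡ (x · - y)) ⟩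
      𝟎 + x · - y     ≡⟨ cong (_+ x · - y) (sym x·y≡𝟎) ⟩
      x · y + x · - y ≡⟨ huntington x (- y) ⟩
      x               ∎

  atom-disjoint : ∀ {u c} → IsAtom u → u ≤ c → ¬ (u ≤ - c)
  atom-disjoint {u} {c} (u≢𝟎 , _) u≤c u≤-c =
    u≢𝟎 (x≤𝟎⇒x≡𝟎 (≤-trans (·-glb u≤c u≤-c) (≤-reflexive (x·-x≡𝟎 c))))

  atom-dichotomy : ∀ {u} → IsAtom u → ∀ c → u ≤ c ⊎ u ≤ - c
  atom-dichotomy {u} (_ , minimal) c =
    Sum.swap (Sum.map x·y≡𝟎⇒x≤-y (λ u·c≡u → subst (_≤ c) u·c≡u (x·y≤y u c)) (minimal (u · c) (x·y≤x u c)))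

  atom-≤⇒≡ : ∀ {u v} → IsAtom u → IsAtom v → u ≤ v → u ≡ v
  atom-≤⇒≡ (u≢𝟎 , _) (_ , minimal) u≤v = Sum.fromInj₂ (λ u≡𝟎 → ⊥-elim (u≢𝟎 u≡𝟎)) (minimal _ u≤v)

  atom-≤-+ : ∀ {u a b} → IsAtom u → u ≤ a + b → u ≤ a ⊎ u ≤ b
  atom-≤-+ {u} {a} {b} u-atom u≤a+b = split (atom-dichotomy u-atom a) (atom-dichotomy u-atom b)
    where
    split : u ≤ a ⊎ u ≤ - a → u ≤ b ⊎ u ≤ - b → u ≤ a ⊎ u ≤ b
    split (inj₁ u≤a)  _           = inj₁ u≤a
    split (inj₂ _)    (inj₁ u≤b)  = inj₂ u≤b
    split (inj₂ u≤-a) (inj₂ u≤-b) = ⊥-elim (atom-disjoint u-atom u≤a+b (subst (u ≤_) -a·-b≡-[a+b] (·-glb u≤-a u≤-b)))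
      where
      -a·-b≡-[a+b] : - a · - b ≡ - (a + b)
      -a·-b≡-[a+b] = cong -_ (cong₂ _+_ (-‿involutive a) (-‿involutive b))

module SymmetricComposition (𝔄 : RelationAlgebra) (symm : RelationAlgebra.IsSymmetric 𝔄) where
  open RelationAlgebra 𝔄
  open Huntington 𝔄
  open ≡-Reasoning

  ⨟-comm : ∀ x y → x ⨟ y ≡ y ⨟ x
  ⨟-comm x y = begin
    x ⨟ y       ≡⟨ sym (symm (x ⨟ y)) ⟩
    (x ⨟ y) ˘   ≡⟨ ˘-⨟ x y ⟩
    y ˘ ⨟ x ˘   ≡⟨ cong₂ _⨟_ (symm y) (symm x) ⟩
    y ⨟ x       ∎

  ⨟-identityˡ : ∀ x → 1' ⨟ x ≡ x
  ⨟-identityˡ x = trans (⨟-comm 1' x) (⨟-identʳ x)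

  ⨟-monoˡ : ∀ {x y} z → x ≤ y → x ⨟ z ≤ y ⨟ z
  ⨟-monoˡ {x} {y} z x≤y = trans (sym (⨟-distr x y z)) (cong (_⨟ z) x≤y)

  ⨟-monoʳ : ∀ z {x y} → x ≤ y → z ⨟ x ≤ z ⨟ y
  ⨟-monoʳ z {x} {y} x≤y = subst₂ _≤_ (⨟-comm x z) (⨟-comm y z) (⨟-monoˡ z x≤y)

  ⨟-mono : ∀ {x y u v} → x ≤ u → y ≤ v → x ⨟ y ≤ u ⨟ v
  ⨟-mono x≤u y≤v = ≤-trans (⨟-monoˡ _ x≤u) (⨟-monoʳ _ y≤v)

  schröder : ∀ {x y z} → x ⨟ y ≤ - z → x ⨟ z ≤ - y
  schröder {x} {y} {z} x⨟y≤-z = ≤-trans (⨟-monoʳ x (x≤-y⇒y≤-x x⨟y≤-z)) tarski′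
    where
    tarski′ : x ⨟ - (x ⨟ y) ≤ - y
    tarski′ = subst (λ w → w ⨟ - (x ⨟ y) ≤ - y) (symm x) (tarski x y)

  atom-rotate : ∀ {x y z} → IsAtom y → IsAtom z → z ≤ x ⨟ y → y ≤ x ⨟ z
  atom-rotate {x} {y} {z} y-atom z-atom z≤x⨟y =
    Sum.fromInj₁ (λ y≤-x⨟z → ⊥-elim (atom-disjoint z-atom ≤-refl (≤-trans z≤x⨟y (schröder (x≤-y⇒y≤-x y≤-x⨟z)))))
                 (atom-dichotomy y-atom (x ⨟ z))

module FiniteAtoms (𝔄 : RelationAlgebra) (fin : RelationAlgebra.IsFinite 𝔄) where
  open RelationAlgebra 𝔄
  open Huntington 𝔄

  _≟_ : DecidableEquality Carrier
  _≟_ = via-injection (↔⇒↣ (proj₂ fin)) Fin._≟_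

  recompute-isAtom : ∀ {x} → .(IsAtom x) → IsAtom x
  recompute-isAtom {x} x-atom =
      recompute (¬? (x ≟ 𝟎)) (proj₁ x-atom)
    , λ y y≤x → recompute ((y ≟ 𝟎) ⊎-dec (y ≟ x)) (proj₂ x-atom y y≤x)

  recompute-isDiversityAtom : ∀ {x} → .(IsDiversityAtom x) → IsDiversityAtom x
  recompute-isDiversityAtom {x} d =
    recompute-isAtom (proj₁ d) , recompute ((x + 0') ≟ 0') (proj₂ d)

  open Inverse (proj₂ fin) using (to; from; strictlyInverseʳ)

  elements : List Carrier
  elements = List.map from (allFin (proj₁ fin))

  ∈-elements : ∀ x → x ∈ elements
  ∈-elements x = subst (_∈ elements) (strictlyInverseʳ x) (∈-map⁺ from (∈-allFin (to x)))

  NonzeroBelow : Carrier → Carrier → Set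
  NonzeroBelow m e = ¬ e ≡ 𝟎 × e ≤ m

  nonzeroBelow? : ∀ m e → Dec (NonzeroBelow m e)
  nonzeroBelow? m e = ¬? (e ≟ 𝟎) ×-dec ((e + m) ≟ m)

  keepIfBelow : ∀ m e → Dec (NonzeroBelow m e) → Carrier
  keepIfBelow m e (yes _) = e
  keepIfBelow m e (no  _) = m

  shrink : List Carrier → Carrier → Carrier
  shrink []       m = m
  shrink (e ∷ es) m = shrink es (keepIfBelow m e (nonzeroBelow? m e))

  shrink-≤ : ∀ es m → shrink es m ≤ m
  shrink-≤ []       m = ≤-refl
  shrink-≤ (e ∷ es) m = ≤-trans (shrink-≤ es _) (keep-≤ (nonzeroBelow? m e))
    where
    keep-≤ : ∀ d → keepIfBelow m e d ≤ m
    keep-≤ (yes (_ , e≤m)) = e≤m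
    keep-≤ (no  _)         = ≤-refl

  shrink-≢𝟎 : ∀ es m → ¬ m ≡ 𝟎 → ¬ shrink es m ≡ 𝟎
  shrink-≢𝟎 []       m m≢𝟎 = m≢𝟎
  shrink-≢𝟎 (e ∷ es) m m≢𝟎 = shrink-≢𝟎 es _ (keep-≢𝟎 (nonzeroBelow? m e))
    where
    keep-≢𝟎 : ∀ d → ¬ keepIfBelow m e d ≡ 𝟎
    keep-≢𝟎 (yes (e≢𝟎 , _)) = e≢𝟎
    keep-≢𝟎 (no  _)         = m≢𝟎

  shrink-minimal : ∀ es m {e} → e ∈ es → ¬ e ≡ 𝟎 → e ≤ shrink es m → e ≡ shrink es m
  shrink-minimal (e ∷ es) m (here refl) e≢𝟎 = keep-minimal (nonzeroBelow? m e)
    where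
    keep-minimal : ∀ d → e ≤ shrink es (keepIfBelow m e d) → e ≡ shrink es (keepIfBelow m e d)
    keep-minimal (yes _)   e≤s = ≤-antisym e≤s (shrink-≤ es e)
    keep-minimal (no  ¬nz) e≤s = ⊥-elim (¬nz (e≢𝟎 , ≤-trans e≤s (shrink-≤ es m)))
  shrink-minimal (e′ ∷ es) m (there e∈es) = shrink-minimal es _ e∈es

  atom-below : ∀ {c} → ¬ c ≡ 𝟎 → Σ Carrier λ u → IsAtom u × u ≤ c
  atom-below {c} c≢𝟎 = u , (shrink-≢𝟎 elements c c≢𝟎 , minimal) , shrink-≤ elements c
    where
    u = shrink elements c
    minimal : ∀ y → y ≤ u → y ≡ 𝟎 ⊎ y ≡ u
    minimal y y≤u = Sum.map₂ (λ y≢𝟎 → shrink-minimal elements c (∈-elements y) y≢𝟎 y≤u) (toSum (y ≟ 𝟎))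

  ≤-from-atoms : ∀ {a b} → (∀ u → IsAtom u → u ≤ a → u ≤ b) → a ≤ b
  ≤-from-atoms {a} {b} atoms⊆ = by-cases ((a · - b) ≟ 𝟎)
    where
    by-cases : Dec (a · - b ≡ 𝟎) → a ≤ b
    by-cases (yes a·-b≡𝟎) = subst (a ≤_) (-‿involutive b) (x·y≡𝟎⇒x≤-y a·-b≡𝟎)
    by-cases (no  a·-b≢𝟎) =
      let u , u-atom , u≤a·-b = atom-below a·-b≢𝟎
      in ⊥-elim (atom-disjoint u-atom (atoms⊆ u u-atom (≤-trans u≤a·-b (x·y≤x a (- b))))
                                      (≤-trans u≤a·-b (x·y≤y a (- b))))

  module _ (symm : IsSymmetric) where
    open SymmetricComposition 𝔄 symm

    atom-below-⨟ʳ : ∀ {z a b} → IsAtom z → z ≤ a ⨟ b → Σ Carrier λ y → IsAtom y × y ≤ b × z ≤ a ⨟ y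
    atom-below-⨟ʳ {z} {a} {b} z-atom z≤a⨟b = refine (atom-below a⨟z·b≢𝟎)
      where
      a⨟z·b≢𝟎 : ¬ (a ⨟ z) · b ≡ 𝟎
      a⨟z·b≢𝟎 eq = atom-disjoint z-atom z≤a⨟b (x≤-y⇒y≤-x (schröder (x·y≡𝟎⇒x≤-y eq)))
      refine : (Σ Carrier λ y → IsAtom y × y ≤ (a ⨟ z) · b) → Σ Carrier λ y → IsAtom y × y ≤ b × z ≤ a ⨟ y
      refine (y , y-atom , y≤a⨟z·b) =
        y , y-atom , ≤-trans y≤a⨟z·b (x·y≤y _ b) , atom-rotate z-atom y-atom (≤-trans y≤a⨟z·b (x·y≤x _ b))

    atoms-below-⨟ : ∀ {z a b} → IsAtom z → z ≤ a ⨟ b →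
      Σ Carrier λ x → Σ Carrier λ y → IsAtom x × IsAtom y × x ≤ a × y ≤ b × z ≤ x ⨟ y
    atoms-below-⨟ {z} {a} {b} z-atom z≤a⨟b =
      let y , y-atom , y≤b , z≤a⨟y = atom-below-⨟ʳ z-atom z≤a⨟b
          x , x-atom , x≤a , z≤y⨟x = atom-below-⨟ʳ z-atom (subst (z ≤_) (⨟-comm a y) z≤a⨟y)
      in x , y , x-atom , y-atom , x≤a , y≤b , subst (z ≤_) (⨟-comm y x) z≤y⨟x

module Representation (𝔄 : RelationAlgebra) (fin : RelationAlgebra.IsFinite 𝔄)
                      (symm : RelationAlgebra.IsSymmetric 𝔄) (intg : RelationAlgebra.IsIntegral 𝔄)
                      (𝔈 : RelationAlgebra.Subalgebra 𝔄) where
  open RelationAlgebra 𝔄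
  open Huntington 𝔄
  open SymmetricComposition 𝔄 symm
  open FiniteAtoms 𝔄 fin
  open Construction 𝔄 𝔈

  ¬diversityAtom≤1' : ∀ {x} → IsDiversityAtom x → ¬ x ≤ 1'
  ¬diversityAtom≤1' (x-atom , x≤0') x≤1' = atom-disjoint x-atom x≤1' x≤0'

  1'≤x⨟y⇒x≡y : ∀ {x y} → IsAtom x → IsAtom y → 1' ≤ x ⨟ y → x ≡ y
  1'≤x⨟y⇒x≡y {x} {y} x-atom y-atom 1'≤x⨟y =
    sym (atom-≤⇒≡ y-atom x-atom (subst (y ≤_) (⨟-identʳ x) (atom-rotate y-atom intg 1'≤x⨟y)))

  classify : ∀ {x} → IsAtom x → x ≡ 1' ⊎ IsDiversityAtom x
  classify x-atom = Sum.map (atom-≤⇒≡ x-atom intg) (x-atom ,_) (atom-dichotomy x-atom 1')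

  atomOf : At → Carrier
  atomOf ι          = 1'
  atomOf (dv x _ _) = x

  atomOf-isAtom : ∀ u → IsAtom (atomOf u)
  atomOf-isAtom ι          = intg
  atomOf-isAtom (dv _ d _) = recompute-isAtom (proj₁ d)

  level : At → ℕ
  level ι          = 0
  level (dv _ _ k) = k

  point : ∀ {x} → x ≡ 1' ⊎ IsDiversityAtom x → ℕ → At
  point     (inj₁ _) k = ι
  point {x} (inj₂ d) k = dv x d k

  atomOf-point : ∀ {x} (c : x ≡ 1' ⊎ IsDiversityAtom x) k → atomOf (point c k) ≡ x
  atomOf-point (inj₁ x≡1') _ = sym x≡1'
  atomOf-point (inj₂ _)    _ = refl

  ∈J⇒≤ : ∀ {a n} u → J a n u → atomOf u ≤ a
  ∈J⇒≤ ι          1'≤a      = 1'≤a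
  ∈J⇒≤ (dv _ _ _) (x≤a , _) = x≤a

  ≤⇒∈J₀ : ∀ {a} u → atomOf u ≤ a → J a 0 u
  ≤⇒∈J₀ ι          1'≤a = 1'≤a
  ≤⇒∈J₀ (dv _ _ _) x≤a  = x≤a , z≤n

  ≤-⨟-comm : ∀ {x y z} → z ≤ x ⨟ y → z ≤ y ⨟ x
  ≤-⨟-comm {x} {y} {z} = subst (z ≤_) (⨟-comm x y)

  Tri⇒≤ : ∀ {u v w} → Tri u v w → atomOf w ≤ atomOf u ⨟ atomOf v
  Tri⇒≤ t111            = ≤-reflexive (sym (⨟-identʳ 1'))
  Tri⇒≤ (t1xx {x})      = ≤-reflexive (sym (⨟-identityˡ x))
  Tri⇒≤ (txyz z≤x⨟y _) = z≤x⨟y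

  Cy⇒≤ : ∀ u v w → Cy u v w → atomOf w ≤ atomOf u ⨟ atomOf v
  Cy⇒≤ u v w (inj₁ t)                               = Tri⇒≤ t
  Cy⇒≤ u v w (inj₂ (inj₁ t))                        = atom-rotate (atomOf-isAtom w) (atomOf-isAtom v) (Tri⇒≤ t)
  Cy⇒≤ u v w (inj₂ (inj₂ (inj₁ t)))                 = ≤-⨟-comm (Tri⇒≤ t)
  Cy⇒≤ u v w (inj₂ (inj₂ (inj₂ (inj₁ t))))          =
    ≤-⨟-comm (atom-rotate (atomOf-isAtom w) (atomOf-isAtom u) (Tri⇒≤ t))
  Cy⇒≤ u v w (inj₂ (inj₂ (inj₂ (inj₂ (inj₁ t)))))   =
    atom-rotate (atomOf-isAtom w) (atomOf-isAtom v) (≤-⨟-comm (Tri⇒≤ t))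
  Cy⇒≤ u v w (inj₂ (inj₂ (inj₂ (inj₂ (inj₂ t)))))   =
    ≤-⨟-comm (atom-rotate (atomOf-isAtom w) (atomOf-isAtom u) (≤-⨟-comm (Tri⇒≤ t)))

  t1xx-≡ : ∀ {x y k} .{p : IsDiversityAtom x} .{q : IsDiversityAtom y} → x ≡ y → Tri ι (dv x p k) (dv y q k)
  t1xx-≡ refl = t1xx

  -- All three points get the same index, and T k k k always holds.
  ≤⇒Cy : ∀ w {x y} (cx : x ≡ 1' ⊎ IsDiversityAtom x) (cy : y ≡ 1' ⊎ IsDiversityAtom y) →
         IsAtom x → IsAtom y → atomOf w ≤ x ⨟ y → Cy (point cx (level w)) (point cy (level w)) w
  ≤⇒Cy ι (inj₁ refl) (inj₁ refl) _ _ _ = inj₁ t111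
  ≤⇒Cy ι (inj₁ refl) (inj₂ dy) _ y-atom 1'≤1'⨟y =
    ⊥-elim (¬diversityAtom≤1' dy (≤-reflexive (sym (1'≤x⨟y⇒x≡y intg y-atom 1'≤1'⨟y))))
  ≤⇒Cy ι (inj₂ dx) (inj₁ refl) x-atom _ 1'≤x⨟1' =
    ⊥-elim (¬diversityAtom≤1' dx (≤-reflexive (1'≤x⨟y⇒x≡y x-atom intg 1'≤x⨟1')))
  ≤⇒Cy ι (inj₂ _) (inj₂ _) x-atom y-atom 1'≤x⨟y =
    inj₂ (inj₂ (inj₂ (inj₂ (inj₁ (t1xx-≡ (1'≤x⨟y⇒x≡y x-atom y-atom 1'≤x⨟y))))))
  ≤⇒Cy (dv z r k) (inj₁ refl) (inj₁ refl) _ _ z≤1'⨟1' =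
    ⊥-elim (¬diversityAtom≤1' (recompute-isDiversityAtom r) (subst (z ≤_) (⨟-identʳ 1') z≤1'⨟1'))
  ≤⇒Cy (dv z r k) (inj₁ refl) (inj₂ _) _ y-atom z≤1'⨟y =
    inj₁ (t1xx-≡ (sym (atom-≤⇒≡ (atomOf-isAtom (dv z r k)) y-atom (subst (z ≤_) (⨟-identityˡ _) z≤1'⨟y))))
  ≤⇒Cy (dv z r k) (inj₂ _) (inj₁ refl) x-atom _ z≤x⨟1' =
    inj₂ (inj₂ (inj₁ (t1xx-≡ (sym (atom-≤⇒≡ (atomOf-isAtom (dv z r k)) x-atom (subst (z ≤_) (⨟-identʳ _) z≤x⨟1'))))))
  ≤⇒Cy (dv _ _ _) (inj₂ _) (inj₂ _) _ _ z≤x⨟y = inj₁ (txyz z≤x⨟y (λ _ → inj₁ (ℕ.≤-refl , refl)))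

  J₀-⨟ : ∀ a b → J (a ⨟ b) 0 ≐ (J a 0 ⨟ᶜ J b 0)
  J₀-⨟ a b = ⊆ , ⊇
    where
    ⊆ : ∀ w → J (a ⨟ b) 0 w → (J a 0 ⨟ᶜ J b 0) w
    ⊆ w w∈J =
      let x , y , x-atom , y-atom , x≤a , y≤b , w≤x⨟y = atoms-below-⨟ symm (atomOf-isAtom w) (∈J⇒≤ w w∈J)
          cx = classify x-atom
          cy = classify y-atom
      in  point cx (level w) , point cy (level w)
        , ≤⇒∈J₀ _ (subst (_≤ a) (sym (atomOf-point cx _)) x≤a)
        , ≤⇒∈J₀ _ (subst (_≤ b) (sym (atomOf-point cy _)) y≤b)
        , ≤⇒Cy w cx cy x-atom y-atom w≤x⨟y
    ⊇ : ∀ w → (J a 0 ⨟ᶜ J b 0) w → J (a ⨟ b) 0 w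
    ⊇ w (u , v , u∈J , v∈J , cy) = ≤⇒∈J₀ w (≤-trans (Cy⇒≤ u v w cy) (⨟-mono (∈J⇒≤ u u∈J) (∈J⇒≤ v v∈J)))

  J₀-+ : ∀ a b → J (a + b) 0 ≐ (J a 0 ∪ᶜ J b 0)
  J₀-+ a b = ⊆ , ⊇
    where
    ⊆ : ∀ w → J (a + b) 0 w → (J a 0 ∪ᶜ J b 0) w
    ⊆ w w∈J = Sum.map (≤⇒∈J₀ w) (≤⇒∈J₀ w) (atom-≤-+ (atomOf-isAtom w) (∈J⇒≤ w w∈J))
    ⊇ : ∀ w → (J a 0 ∪ᶜ J b 0) w → J (a + b) 0 w
    ⊇ w (inj₁ w∈Ja) = ≤⇒∈J₀ w (≤-trans (∈J⇒≤ w w∈Ja) (x≤x+y a b))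
    ⊇ w (inj₂ w∈Jb) = ≤⇒∈J₀ w (≤-trans (∈J⇒≤ w w∈Jb) (y≤x+y a b))

  J₀-- : ∀ a → J (- a) 0 ≐ ∁ᶜ (J a 0)
  J₀-- a = ⊆ , ⊇
    where
    ⊆ : ∀ w → J (- a) 0 w → ∁ᶜ (J a 0) w
    ⊆ w w∈J-a w∈Ja = atom-disjoint (atomOf-isAtom w) (∈J⇒≤ w w∈Ja) (∈J⇒≤ w w∈J-a)
    ⊇ : ∀ w → ∁ᶜ (J a 0) w → J (- a) 0 w
    ⊇ w w∉Ja = ≤⇒∈J₀ w (Sum.fromInj₂ (λ w≤a → ⊥-elim (w∉Ja (≤⇒∈J₀ w w≤a))) (atom-dichotomy (atomOf-isAtom w) a))

  J₀-1' : J 1' 0 ≐ 1ᶜ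
  J₀-1' = ⊆ , ⊇
    where
    ⊆ : ∀ w → J 1' 0 w → 1ᶜ w
    ⊆ ι          _         = refl
    ⊆ (dv _ d _) (x≤1' , _) = ⊥-elim (¬diversityAtom≤1' (recompute-isDiversityAtom d) x≤1')
    ⊇ : ∀ w → 1ᶜ w → J 1' 0 w
    ⊇ ι refl = ≤-refl

  J₀-˘ : ∀ a → J (a ˘) 0 ≐ ˘ᶜ (J a 0)
  J₀-˘ a = (λ w → subst (λ c → J c 0 w) (symm a)) , (λ w → subst (λ c → J c 0 w) (sym (symm a)))

  J₀-injective : ∀ a b → J a 0 ≐ J b 0 → a ≡ b
  J₀-injective a b (⊆ , ⊇) = ≤-antisym (≤-from-atoms (atomwise ⊆)) (≤-from-atoms (atomwise ⊇))
    where
    atomwise : ∀ {c d} → (∀ w → J c 0 w → J d 0 w) → ∀ u → IsAtom u → u ≤ c → u ≤ d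
    atomwise {c} {d} J⊆J u u-atom u≤c =
      subst (_≤ d) pt≡u (∈J⇒≤ pt (J⊆J pt (≤⇒∈J₀ pt (subst (_≤ c) (sym pt≡u) u≤c))))
      where
      pt = point (classify u-atom) 0
      pt≡u = atomOf-point (classify u-atom) 0

lemma2 : (𝔄 : RelationAlgebra) → RelationAlgebra.IsFinite 𝔄 →
         RelationAlgebra.IsSymmetric 𝔄 → RelationAlgebra.IsIntegral 𝔄 →
         (𝔈 : RelationAlgebra.Subalgebra 𝔄) →
         Construction.IsEmbedding 𝔄 𝔈 (λ a → Construction.J 𝔄 𝔈 a 0)
lemma2 𝔄 fin symm intg 𝔈 = J₀-injective , J₀-+ , J₀-- , J₀-⨟ , J₀-˘ , J₀-1'
  where open Representation 𝔄 fin symm intg 𝔈
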